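{- There exists a request sequence $\sigma$ on a uniform metric such that under LRU, one server incurs cost $\Omega(\mathrm{cost}(\mathrm{LRU},\sigma))$ while all other servers incur only $O(1)$ cost. Consequently, LRU does not satisfy $(\alpha,\beta)$-fairness with respect to its own total cost for any $\alpha=o(k)$ and any $\beta=o(\mathrm{cost}(\mathrm{LRU},\sigma))$.
   Context: $k$-server problem on a uniform metric (all distinct points at distance $1$), equivalently paging: $k$ servers (cache slots) occupy points (pages); on a request to a point with no server (a fault), some server must move there at cost $1$. $c_i$ is the cost of server $i$, $\mathrm{cost}=\sum_i c_i$. LRU (Least Recently Used), on a fault, moves the server whose current page was least recently requested. An algorithm is $(\alpha,\beta)$-fair with respect to its own cost if for all request sequences each server satisfies $c_i\le \alpha\,\mathrm{cost}/k+\beta$. Asymptotic notation refers to the sequence length (and hence $\mathrm{cost}(\mathrm{LRU},\sigma)$) growing, with $k$ fixed. -}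

module Defs where

open import Data.Nat using (ℕ; zero; suc; _≡ᵇ_; _<ᵇ_; _≤_)
open import Data.Bool using (Bool; true; false; if_then_else_)
open import Data.Fin using (Fin; zero; suc; _≟_)
open import Data.Maybe using (Maybe; just; nothing)
import Data.Maybe as Maybe
open import Data.List using (List; []; _∷_; map)
open import Data.Nat.ListAction using (sum)
open import Data.List using (allFin)
open import Data.Product using (Σ; _×_; _,_; ∃)
open import Function using (_∘_)
open import Relation.Nullary.Decidable using (⌊_⌋)
open import Data.Integer using (+_)
import Data.Rational as ℚ
open ℚ using (ℚ; 0ℚ)

-- Uniform metric: points are natural numbers, any two distinct points at distance 1.
-- k servers indexed by Fin k.

findAt : ∀ {k} → (Fin k → ℕ) → ℕ → Maybe (Fin k)
findAt {zero} pos p = nothing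
findAt {suc k} pos p =
  if pos zero ≡ᵇ p then just zero else Maybe.map suc (findAt (pos ∘ suc) p)

argmin : ∀ {k} → (Fin (suc k) → ℕ) → Fin (suc k)
argmin {zero} f = zero
argmin {suc k} f =
  let j = suc (argmin (f ∘ suc)) in
  if f j <ᵇ f zero then j else zero

updateAt : ∀ {k} {A : Set} → (Fin k → A) → Fin k → A → (Fin k → A)
updateAt f i v j = if ⌊ j ≟ i ⌋ then v else f j

-- LRU state: positions, time of the last request served by each server
-- (0 = never), accumulated cost of each server, current time.
record State (k : ℕ) : Set where
  constructor st
  field
    pos  : Fin k → ℕ
    last : Fin k → ℕ
    cost : Fin k → ℕ
    time : ℕ
open State public

lruStep : ∀ {k} → State k → ℕ → State k
lruStep {k} (st ps ls cs t) p with findAt ps p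
... | just i = st ps (updateAt ls i (suc t)) cs (suc t)
lruStep {zero} (st ps ls cs t) p | nothing = st ps ls cs (suc t)
lruStep {suc k} (st ps ls cs t) p | nothing =
  let i = argmin ls in
  st (updateAt ps i p) (updateAt ls i (suc t)) (updateAt cs i (suc (cs i))) (suc t)

lruRun : ∀ {k} → State k → List ℕ → State k
lruRun s [] = s
lruRun s (p ∷ σ) = lruRun (lruStep s p) σ

initState : ∀ {k} → (Fin k → ℕ) → State k
initState init = st init (λ _ → 0) (λ _ → 0) 0

serverCost : ∀ {k} → (Fin k → ℕ) → List ℕ → Fin k → ℕ
serverCost init σ = cost (lruRun (initState init) σ)

totalCost : ∀ {k} → (Fin k → ℕ) → List ℕ → ℕ
totalCost {k} init σ = sum (map (serverCost init σ) (allFin k))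

ℕ→ℚ : ℕ → ℚ
ℕ→ℚ n = + n ℚ./ 1

IsLittleO : (ℕ → ℚ) → Set
IsLittleO f = ∀ (ε : ℚ) → 0ℚ ℚ.< ε →
  Σ ℕ λ n₀ → ∀ n → n₀ ≤ n → f n ℚ.≤ ε ℚ.* ℕ→ℚ n

-- LRU violates (α,β)-fairness on σ via server i:  c_i > α·cost/k + β,
-- written multiplied out by k > 0:  α·cost + k·β < k·c_i
ViolatesFairness : ∀ {k} → (Fin k → ℕ) → ℚ → ℚ → List ℕ → Fin k → Set
ViolatesFairness {k} init α β σ i =
  α ℚ.* ℕ→ℚ (totalCost init σ) ℚ.+ ℕ→ℚ k ℚ.* β ℚ.< ℕ→ℚ k ℚ.* ℕ→ℚ (serverCost init σ i)

{-# OPTIONS --safe #-}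
-- Fix a page base M above every initially occupied page and call server 0 the victim.
-- A warm-up of k faults sends server i to page M + i.  Then the adversary repeats blocks:
-- a fresh page, followed by the home pages M + 1, …, M + k − 1 of the other servers.
-- Those re-requests are hits that refresh every other server, so at the next fresh page
-- the victim is least recently used and pays again.  After N blocks the victim has paid
-- N + 1 and every other server 1, out of a total of N + k.  For fairness, take ε = ¼ in
-- both o-bounds: then α·cost + k·β ≤ k·cost/2 < k·(N + 1) as soon as N ≥ k.
module Submission where

open import Defs
open import Data.Nat
  using (ℕ; zero; suc; _+_; _*_; _≤_; _<_; _<?_; _≡ᵇ_; _<ᵇ_; z≤n; s≤s; z<s; s<s; s≤s⁻¹)
open import Data.Nat.Properties hiding (_≟_)
open import Data.Fin using (Fin; zero; suc; toℕ; fromℕ<; _≟_)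
open import Data.Fin.Properties using (toℕ-fromℕ<; toℕ-injective; toℕ<n)
  renaming (suc-injective to Fin-suc-injective)
open import Data.Bool using (true; false; T)
open import Data.Maybe using (just; nothing)
open import Data.List using (List; []; _∷_; _++_; _∷ʳ_; map; allFin; tabulate; applyUpTo)
open import Data.List.Properties using (applyUpTo-∷ʳ; map-tabulate)
open import Data.List.Membership.Propositional using (_∈_)
open import Data.List.Membership.Propositional.Properties using (∈-allFin; ∈-tabulate⁺)
open import Data.List.Relation.Unary.Any using (here; there)
import Data.List.Relation.Unary.All as All
open import Data.List.Extrema.Nat using (max; xs≤max)
open import Data.Nat.ListAction using (sum)
open import Data.Product using (Σ; _×_; _,_; proj₁; uncurry)
open import Data.Sum using (_⊎_; inj₁; inj₂; [_,_])
open import Data.Empty using (⊥-elim)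
open import Function using (id; _∘_)
open import Data.Integer using (+≤+; +<+)
import Data.Integer as ℤ
import Data.Integer.Properties as ℤₚ
open import Data.Rational using (ℚ; ½)
import Data.Rational as ℚ
import Data.Rational.Properties as ℚₚ
import Data.Rational.Unnormalised as ℚᵘ
import Data.Rational.Unnormalised.Properties as ℚᵘₚ
open import Data.Rational.Solver using (module +-*-Solver)
open import Relation.Nullary using (yes; no; contradiction)
open import Relation.Binary.PropositionalEquality
  using (_≡_; _≢_; refl; sym; trans; cong; cong₂; subst; subst₂; module ≡-Reasoning)

findAt-nothing : ∀ {k} (ps : Fin k → ℕ) {p} → (∀ x → ps x ≢ p) → findAt ps p ≡ nothing
findAt-nothing {zero} ps absent = refl
findAt-nothing {suc k} ps {p} absent with ps zero ≡ᵇ p in eq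
... | true = contradiction (≡ᵇ⇒≡ _ _ (subst T (sym eq) _)) (absent zero)
... | false rewrite findAt-nothing (ps ∘ suc) (absent ∘ suc) = refl

findAt-just : ∀ {k} (ps : Fin k → ℕ) {p} i → ps i ≡ p → (∀ x → ps x ≡ p → x ≡ i) →
              findAt ps p ≡ just i
findAt-just {suc k} ps {p} i _ unique with ps zero ≡ᵇ p in eq
... | true = cong just (unique zero (≡ᵇ⇒≡ _ _ (subst T (sym eq) _)))
findAt-just {suc k} ps zero ps0≡p _ | false = ⊥-elim (subst T eq (≡⇒≡ᵇ _ _ ps0≡p))
findAt-just {suc k} ps (suc i) psi≡p unique | false
  rewrite findAt-just (ps ∘ suc) i psi≡p (λ x e → Fin-suc-injective (unique (suc x) e)) = refl

argmin-first-minimum : ∀ {k} (f : Fin (suc k) → ℕ) i → (∀ x → f i ≤ f x) →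
                       (∀ x → toℕ x < toℕ i → f i < f x) → argmin f ≡ i
argmin-first-minimum {zero} f zero _ _ = refl
argmin-first-minimum {suc k} f zero minimal _ with f (suc (argmin (f ∘ suc))) <ᵇ f zero in eq
... | true  = contradiction (<ᵇ⇒< _ _ (subst T (sym eq) _)) (≤⇒≯ (minimal _))
... | false = refl
argmin-first-minimum {suc k} f (suc i) minimal first
  rewrite argmin-first-minimum (f ∘ suc) i (minimal ∘ suc) (λ x → first (suc x) ∘ s<s)
  with f (suc i) <ᵇ f zero in eq
... | true  = refl
... | false = ⊥-elim (subst T eq (<⇒<ᵇ (first zero z<s)))

updateAt-updates : ∀ {k} {A : Set} (f : Fin k → A) i v → updateAt f i v i ≡ v
updateAt-updates f i v with i ≟ i
... | yes _  = refl
... | no i≢i = contradiction refl i≢i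

updateAt-minimal : ∀ {k} {A : Set} (f : Fin k → A) i v {x} → x ≢ i → updateAt f i v x ≡ f x
updateAt-minimal f i v {x} x≢i with x ≟ i
... | yes x≡i = contradiction x≡i x≢i
... | no _    = refl

lruStep-fault : ∀ {m} (ps ls cs : Fin (suc m) → ℕ) t {p} i →
                findAt ps p ≡ nothing → argmin ls ≡ i →
                lruStep (st ps ls cs t) p ≡
                st (updateAt ps i p) (updateAt ls i (suc t)) (updateAt cs i (suc (cs i))) (suc t)
lruStep-fault ps ls cs t i miss refl rewrite miss = refl

lruStep-hit : ∀ {k} (ps ls cs : Fin k → ℕ) t {p} i → findAt ps p ≡ just i →
              lruStep (st ps ls cs t) p ≡ st ps (updateAt ls i (suc t)) cs (suc t)
lruStep-hit ps ls cs t i hit rewrite hit = refl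

lruRun-++ : ∀ {k} (s : State k) σ τ → lruRun s (σ ++ τ) ≡ lruRun (lruRun s σ) τ
lruRun-++ s []      τ = refl
lruRun-++ s (p ∷ σ) τ = lruRun-++ (lruStep s p) σ τ

lruRun-∷ʳ : ∀ {k} (s : State k) σ p → lruRun s (σ ∷ʳ p) ≡ lruStep (lruRun s σ) p
lruRun-∷ʳ s σ p = lruRun-++ s σ (p ∷ [])

sum-tabulate-ones : ∀ {m} (h : Fin m → ℕ) → (∀ j → h j ≡ 1) → sum (tabulate h) ≡ m
sum-tabulate-ones {zero}  h ones = refl
sum-tabulate-ones {suc m} h ones = cong₂ _+_ (ones zero) (sum-tabulate-ones (h ∘ suc) (ones ∘ suc))

module _ {m : ℕ} (M : ℕ) where

  record Served (s : State (suc m)) (x : Fin (suc m)) : Set where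
    field
      page     : pos s x ≡ M + toℕ x
      lastUsed : last s x ≡ suc (toℕ x)
      paid     : cost s x ≡ 1

  record Untouched (s : State (suc m)) (x : Fin (suc m)) : Set where
    field
      page     : pos s x < M
      lastUsed : last s x ≡ 0
      paid     : cost s x ≡ 0

  record WarmingUp (n : ℕ) (s : State (suc m)) : Set where
    field
      served    : ∀ x → toℕ x < n → Served s x
      untouched : ∀ x → n ≤ toℕ x → Untouched s x
      clock     : time s ≡ n

  warmUp-step : ∀ {n s} → WarmingUp n s → (n<k : n < suc m) →
                WarmingUp (suc n) (lruStep s (M + n))
  warmUp-step {n} {st ps ls cs t} w n<k =
    subst (WarmingUp (suc n)) (sym (lruStep-fault ps ls cs t i miss lru))
      (record { served = served′ ; untouched = untouched′ ; clock = cong suc clock })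
    where
    open WarmingUp w
    i : Fin (suc m)
    i = fromℕ< n<k
    toℕi : toℕ i ≡ n
    toℕi = toℕ-fromℕ< n<k
    module I = Untouched (untouched i (≤-reflexive (sym toℕi)))

    miss : findAt ps (M + n) ≡ nothing
    miss = findAt-nothing ps absent
      where
      absent : ∀ x → ps x ≢ M + n
      absent x e with toℕ x <? n
      ... | yes x<n = <⇒≢ x<n (+-cancelˡ-≡ M _ _ (trans (sym (Served.page (served x x<n))) e))
      ... | no  x≮n = <⇒≱ (Untouched.page (untouched x (≮⇒≥ x≮n)))
                          (subst (M ≤_) (sym e) (m≤m+n M n))

    lru : argmin ls ≡ i
    lru = argmin-first-minimum ls i (λ x → subst (_≤ ls x) (sym I.lastUsed) z≤n)
      (λ x x<i → subst₂ _<_ (sym I.lastUsed)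
                   (sym (Served.lastUsed (served x (subst (toℕ x <_) toℕi x<i)))) z<s)

    s′ : State (suc m)
    s′ = st (updateAt ps i (M + n)) (updateAt ls i (suc t)) (updateAt cs i (suc (cs i))) (suc t)

    served′ : ∀ x → toℕ x < suc n → Served s′ x
    served′ x x≤n with x ≟ i
    ... | yes refl = record
      { page     = trans (updateAt-updates ps i _) (cong (M +_) (sym toℕi))
      ; lastUsed = trans (updateAt-updates ls i _) (cong suc (trans clock (sym toℕi)))
      ; paid     = trans (updateAt-updates cs i _) (cong suc I.paid) }
    ... | no x≢i = record
      { page     = trans (updateAt-minimal ps i _ x≢i) page
      ; lastUsed = trans (updateAt-minimal ls i _ x≢i) lastUsed
      ; paid     = trans (updateAt-minimal cs i _ x≢i) paid }
      where
      open Served (served x (≤∧≢⇒< (s≤s⁻¹ x≤n) (λ e → x≢i (toℕ-injective (trans e (sym toℕi))))))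

    untouched′ : ∀ x → suc n ≤ toℕ x → Untouched s′ x
    untouched′ x n<x with x ≟ i
    ... | yes refl = contradiction (sym toℕi) (<⇒≢ n<x)
    ... | no x≢i   = record
      { page     = subst (_< M) (sym (updateAt-minimal ps i _ x≢i)) page
      ; lastUsed = trans (updateAt-minimal ls i _ x≢i) lastUsed
      ; paid     = trans (updateAt-minimal cs i _ x≢i) paid }
      where open Untouched (untouched x (<⇒≤ n<x))

  warmUp : (init : Fin (suc m) → ℕ) → (∀ x → init x < M) → ∀ n → n ≤ suc m →
           WarmingUp n (lruRun (initState init) (applyUpTo (M +_) n))
  warmUp init below zero _ = record
    { served    = λ _ ()
    ; untouched = λ x _ → record { page = below x ; lastUsed = refl ; paid = refl }
    ; clock     = refl
    }
  warmUp init below (suc n) n<k =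
    subst (WarmingUp (suc n)) (sym (begin
      lruRun s₀ (applyUpTo (M +_) (suc n))         ≡⟨ cong (lruRun s₀) (applyUpTo-∷ʳ (M +_) n) ⟨
      lruRun s₀ (applyUpTo (M +_) n ∷ʳ (M + n))    ≡⟨ lruRun-∷ʳ s₀ (applyUpTo (M +_) n) (M + n) ⟩
      lruStep (lruRun s₀ (applyUpTo (M +_) n)) (M + n) ∎))
      (warmUp-step (warmUp init below n (<⇒≤ n<k)) n<k)
    where
    open ≡-Reasoning
    s₀ = initState init

  home : Fin m → ℕ
  home j = M + toℕ (suc j)

  victimPage : ℕ → ℕ
  victimPage zero    = M
  victimPage (suc n) = M + suc m + n

  home-injective : ∀ {i j} → home i ≡ home j → i ≡ j
  home-injective e = toℕ-injective (suc-injective (+-cancelˡ-≡ M _ _ e))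

  victimPage≢home : ∀ n j → victimPage n ≢ home j
  victimPage≢home zero    j = <⇒≢ (m<m+n M z<s)
  victimPage≢home (suc n) j = >⇒≢ (≤-trans (+-monoʳ-< M (s<s (toℕ<n j))) (m≤m+n (M + suc m) n))

  victimPage-< : ∀ n → victimPage n < victimPage (suc n)
  victimPage-< zero    = ≤-trans (m<m+n M z<s) (m≤m+n (M + suc m) 0)
  victimPage-< (suc n) = +-monoʳ-< (M + suc m) (n<1+n n)

  record Steady (n : ℕ) (s : State (suc m)) : Set where
    field
      victim-pos  : pos s zero ≡ victimPage n
      home-pos    : ∀ j → pos s (suc j) ≡ home j
      victim-cost : cost s zero ≡ suc n
      home-cost   : ∀ j → cost s (suc j) ≡ 1
      victim-last : last s zero ≤ time s

  VictimStaler : State (suc m) → Fin m → Set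
  VictimStaler s j = last s zero ≤ last s (suc j)

  hit : ∀ {n s} j → Steady n s →
        Steady n (lruStep s (home j)) ×
        (∀ j′ → VictimStaler s j′ ⊎ j′ ≡ j → VictimStaler (lruStep s (home j)) j′)
  hit {n} {st ps ls cs t} j S =
    subst (λ s → Steady n s × (∀ j′ → VictimStaler (st ps ls cs t) j′ ⊎ j′ ≡ j → VictimStaler s j′))
      (sym (lruStep-hit ps ls cs t (suc j) found))
      (record { Steady S ; victim-last = m≤n⇒m≤1+n victim-last } , staler)
    where
    open Steady S
    found : findAt ps (home j) ≡ just (suc j)
    found = findAt-just ps (suc j) (home-pos j) λ where
      zero     e → contradiction (trans (sym victim-pos) e) (victimPage≢home n j)
      (suc j′) e → cong suc (home-injective (trans (sym (home-pos j′)) e))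
    staler : ∀ j′ → VictimStaler (st ps ls cs t) j′ ⊎ j′ ≡ j →
             ls zero ≤ updateAt ls (suc j) (suc t) (suc j′)
    staler j′ stale-or-hit with j′ ≟ j | stale-or-hit
    ... | yes refl | _          = m≤n⇒m≤1+n victim-last
    ... | no _     | inj₁ stale = stale
    ... | no j′≢j  | inj₂ j′≡j  = contradiction j′≡j j′≢j

  hits : ∀ {n s} js → Steady n s → (∀ j → VictimStaler s j ⊎ j ∈ js) →
         Steady n (lruRun s (map home js)) × (∀ j → VictimStaler (lruRun s (map home js)) j)
  hits [] S stale-or-hit = S , λ j → [ id , (λ ()) ] (stale-or-hit j)
  hits {s = s} (j ∷ js) S stale-or-hit with hit j S
  ... | S′ , staler = hits js S′ stale-or-hit′
    where
    stale-or-hit′ : ∀ j′ → VictimStaler (lruStep s (home j)) j′ ⊎ j′ ∈ js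
    stale-or-hit′ j′ with stale-or-hit j′
    ... | inj₁ stale          = inj₁ (staler j′ (inj₁ stale))
    ... | inj₂ (here j′≡j)    = inj₁ (staler j′ (inj₂ j′≡j))
    ... | inj₂ (there j′∈js) = inj₂ j′∈js

  fault : ∀ {n s} → Steady n s → (∀ j → VictimStaler s j) →
          Steady (suc n) (lruStep s (victimPage (suc n)))
  fault {n} {st ps ls cs t} S staler =
    subst (Steady (suc n)) (sym (lruStep-fault ps ls cs t zero miss lru)) (record
      { victim-pos  = refl
      ; home-pos    = home-pos
      ; victim-cost = cong suc victim-cost
      ; home-cost   = home-cost
      ; victim-last = ≤-refl
      })
    where
    open Steady S
    miss : findAt ps (victimPage (suc n)) ≡ nothing
    miss = findAt-nothing ps λ where
      zero    e → <⇒≢ (victimPage-< n) (trans (sym victim-pos) e)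
      (suc j) e → victimPage≢home (suc n) j (trans (sym e) (home-pos j))
    lru : argmin ls ≡ zero
    lru = argmin-first-minimum ls zero (λ where zero → ≤-refl ; (suc j) → staler j) (λ _ ())

  block : ℕ → List ℕ
  block n = victimPage (suc n) ∷ map home (allFin m)

  serve-block : ∀ {n s} → Steady n s → (∀ j → VictimStaler s j) →
                Steady (suc n) (lruRun s (block n)) × (∀ j → VictimStaler (lruRun s (block n)) j)
  serve-block S staler = hits (allFin m) (fault S staler) (inj₂ ∘ ∈-allFin)

  warmedUp⇒steady : ∀ {s} → WarmingUp (suc m) s → Steady 0 s × (∀ j → VictimStaler s j)
  warmedUp⇒steady w =
    record
      { victim-pos  = trans V.page (+-identityʳ M)
      ; home-pos    = λ j → Served.page (H j)
      ; victim-cost = V.paid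
      ; home-cost   = λ j → Served.paid (H j)
      ; victim-last = subst₂ _≤_ (sym V.lastUsed) (sym clock) (s≤s z≤n)
      } ,
    λ j → subst₂ _≤_ (sym V.lastUsed) (sym (Served.lastUsed (H j))) (s≤s z≤n)
    where
    open WarmingUp w
    module V = Served (served zero z<s)
    H : ∀ j → Served _ (suc j)
    H j = served (suc j) (toℕ<n (suc j))

  requests : ℕ → List ℕ
  requests zero    = applyUpTo (M +_) (suc m)
  requests (suc N) = requests N ++ block N

  serve-requests : (init : Fin (suc m) → ℕ) → (∀ x → init x < M) → ∀ N →
                   let s = lruRun (initState init) (requests N) in
                   Steady N s × (∀ j → VictimStaler s j)
  serve-requests init below zero    = warmedUp⇒steady (warmUp init below (suc m) ≤-refl)
  serve-requests init below (suc N) rewrite lruRun-++ (initState init) (requests N) (block N) =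
    uncurry serve-block (serve-requests init below N)

freshBase : ∀ {k} → (Fin k → ℕ) → ℕ
freshBase init = suc (max 0 (tabulate init))

init<freshBase : ∀ {k} (init : Fin k → ℕ) x → init x < freshBase init
init<freshBase init x = s≤s (All.lookup (xs≤max 0 (tabulate init)) (∈-tabulate⁺ x))

adversary : ∀ {m} → (Fin (suc m) → ℕ) → ℕ → List ℕ
adversary {m} init = requests {m} (freshBase init)

module _ {m} (init : Fin (suc m) → ℕ) (N : ℕ) where

  private
    module S = Steady (proj₁ (serve-requests (freshBase init) init (init<freshBase init) N))

  victim-serverCost : serverCost init (adversary init N) zero ≡ suc N
  victim-serverCost = S.victim-cost

  home-serverCost : ∀ j → serverCost init (adversary init N) (suc j) ≡ 1
  home-serverCost = S.home-cost

  adversary-totalCost : totalCost init (adversary init N) ≡ suc N + m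
  adversary-totalCost = begin
    sum (map c (allFin (suc m)))      ≡⟨ cong sum (map-tabulate id c) ⟩
    c zero + sum (tabulate (c ∘ suc)) ≡⟨ cong₂ _+_ victim-serverCost
                                                   (sum-tabulate-ones (c ∘ suc) home-serverCost) ⟩
    suc N + m                         ∎
    where
    open ≡-Reasoning
    c = serverCost init (adversary init N)

ℕ→ℚᵘ : ℕ → ℚᵘ.ℚᵘ
ℕ→ℚᵘ n = ℚᵘ.mkℚᵘ (ℤ.+ n) 0

ℕ→ℚᵘ-mono-≤ : ∀ {m n} → m ≤ n → ℕ→ℚᵘ m ℚᵘ.≤ ℕ→ℚᵘ n
ℕ→ℚᵘ-mono-≤ m≤n = ℚᵘ.*≤* (ℤₚ.*-monoʳ-≤-nonNeg (ℤ.+ 1) (+≤+ m≤n))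

ℕ→ℚᵘ-mono-< : ∀ {m n} → m < n → ℕ→ℚᵘ m ℚᵘ.< ℕ→ℚᵘ n
ℕ→ℚᵘ-mono-< m<n = ℚᵘ.*<* (ℤₚ.*-monoʳ-<-pos (ℤ.+ 1) (+<+ m<n))

ℕ→ℚᵘ-homo-+ : ∀ m n → ℕ→ℚᵘ (m + n) ℚᵘ.≃ ℕ→ℚᵘ m ℚᵘ.+ ℕ→ℚᵘ n
ℕ→ℚᵘ-homo-+ m n = ℚᵘ.*≡* (cong (ℤ._* ℤ.+ 1)
  (trans (ℤₚ.pos-+ m n) (sym (cong₂ ℤ._+_ (ℤₚ.*-identityʳ (ℤ.+ m)) (ℤₚ.*-identityʳ (ℤ.+ n))))))

module _ {p q : ℚᵘ.ℚᵘ} where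

  private
    toℚᵘ-fromℚᵘ⁻¹ : ∀ r → r ℚᵘ.≃ ℚ.toℚᵘ (ℚ.fromℚᵘ r)
    toℚᵘ-fromℚᵘ⁻¹ r = ℚᵘₚ.≃-sym (ℚₚ.toℚᵘ-fromℚᵘ r)

  fromℚᵘ-mono-≤ : p ℚᵘ.≤ q → ℚ.fromℚᵘ p ℚ.≤ ℚ.fromℚᵘ q
  fromℚᵘ-mono-≤ p≤q = ℚₚ.toℚᵘ-cancel-≤
    (ℚᵘₚ.≤-respˡ-≃ (toℚᵘ-fromℚᵘ⁻¹ p) (ℚᵘₚ.≤-respʳ-≃ (toℚᵘ-fromℚᵘ⁻¹ q) p≤q))

  fromℚᵘ-mono-< : p ℚᵘ.< q → ℚ.fromℚᵘ p ℚ.< ℚ.fromℚᵘ q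
  fromℚᵘ-mono-< p<q = ℚₚ.toℚᵘ-cancel-<
    (ℚᵘₚ.<-respˡ-≃ (toℚᵘ-fromℚᵘ⁻¹ p) (ℚᵘₚ.<-respʳ-≃ (toℚᵘ-fromℚᵘ⁻¹ q) p<q))

  fromℚᵘ-homo-+ : ℚ.fromℚᵘ (p ℚᵘ.+ q) ≡ ℚ.fromℚᵘ p ℚ.+ ℚ.fromℚᵘ q
  fromℚᵘ-homo-+ = ℚₚ.toℚᵘ-injective (ℚᵘₚ.≃-trans (ℚₚ.toℚᵘ-fromℚᵘ (p ℚᵘ.+ q))
    (ℚᵘₚ.≃-trans (ℚᵘₚ.+-cong (toℚᵘ-fromℚᵘ⁻¹ p) (toℚᵘ-fromℚᵘ⁻¹ q))
      (ℚᵘₚ.≃-sym (ℚₚ.toℚᵘ-homo-+ (ℚ.fromℚᵘ p) (ℚ.fromℚᵘ q)))))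

ℕ→ℚ-mono-≤ : ∀ {m n} → m ≤ n → ℕ→ℚ m ℚ.≤ ℕ→ℚ n
ℕ→ℚ-mono-≤ {m} {n} = fromℚᵘ-mono-≤ {ℕ→ℚᵘ m} {ℕ→ℚᵘ n} ∘ ℕ→ℚᵘ-mono-≤

ℕ→ℚ-mono-< : ∀ {m n} → m < n → ℕ→ℚ m ℚ.< ℕ→ℚ n
ℕ→ℚ-mono-< {m} {n} = fromℚᵘ-mono-< {ℕ→ℚᵘ m} {ℕ→ℚᵘ n} ∘ ℕ→ℚᵘ-mono-<

ℕ→ℚ-homo-+ : ∀ m n → ℕ→ℚ (m + n) ≡ ℕ→ℚ m ℚ.+ ℕ→ℚ n
ℕ→ℚ-homo-+ m n = trans (ℚₚ.fromℚᵘ-cong (ℕ→ℚᵘ-homo-+ m n)) (fromℚᵘ-homo-+ {ℕ→ℚᵘ m} {ℕ→ℚᵘ n})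

¼ : ℚ
¼ = ℤ.+ 1 ℚ./ 4

quarter-bounds⇒< : ∀ {a b K T C : ℚ} .{{_ : ℚ.Positive K}} .{{_ : ℚ.NonNegative T}} →
                   a ℚ.≤ ¼ ℚ.* K → b ℚ.≤ ¼ ℚ.* T → T ℚ.< C ℚ.+ C →
                   a ℚ.* T ℚ.+ K ℚ.* b ℚ.< K ℚ.* C
quarter-bounds⇒< {a} {b} {K} {T} {C} a≤K/4 b≤T/4 T<2C = begin-strict
  a ℚ.* T ℚ.+ K ℚ.* b               ≤⟨ ℚₚ.+-mono-≤ (ℚₚ.*-monoʳ-≤-nonNeg T a≤K/4)
                                                    (ℚₚ.*-monoˡ-≤-nonNeg K {{ℚₚ.pos⇒nonNeg K}} b≤T/4) ⟩
  ¼ ℚ.* K ℚ.* T ℚ.+ K ℚ.* (¼ ℚ.* T) ≡⟨ quarters ¼ K T ⟩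
  K ℚ.* (½ ℚ.* T)                   <⟨ ℚₚ.*-monoʳ-<-pos K (ℚₚ.*-monoʳ-<-pos ½ T<2C) ⟩
  K ℚ.* (½ ℚ.* (C ℚ.+ C))           ≡⟨ cong (K ℚ.*_) (trans (halves ½ C) (ℚₚ.*-identityˡ C)) ⟩
  K ℚ.* C                           ∎
  where
  open ℚₚ.≤-Reasoning
  open +-*-Solver
  quarters = solve 3 (λ q k t → q :* k :* t :+ k :* (q :* t) := k :* ((q :+ q) :* t)) refl
  halves   = solve 2 (λ h c → h :* (c :+ c) := (h :+ h) :* c) refl

ℕ→ℚ-suc-positive : ∀ n → ℚ.Positive (ℕ→ℚ (suc n))
ℕ→ℚ-suc-positive n = ℚ.positive (ℕ→ℚ-mono-< (s≤s (z≤n {n})))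

ℕ→ℚ-nonNegative : ∀ n → ℚ.NonNegative (ℕ→ℚ n)
ℕ→ℚ-nonNegative n = ℚ.nonNegative (ℕ→ℚ-mono-≤ (z≤n {n}))

lru-concentrates-cost : ∀ k → 1 ≤ k → (init : Fin k → ℕ) →
  Σ ℕ λ a → Σ ℕ λ b → 1 ≤ a ×
    (∀ N → Σ (List ℕ) λ σ → N ≤ totalCost init σ ×
      Σ (Fin k) λ i → totalCost init σ ≤ a * serverCost init σ i ×
        (∀ j → j ≢ i → serverCost init σ j ≤ b))
lru-concentrates-cost (suc m) _ init = suc m , 1 , s≤s z≤n , λ N →
  adversary init N ,
  subst (N ≤_) (sym (adversary-totalCost init N)) (≤-trans (n≤1+n N) (m≤m+n (suc N) m)) ,
  zero ,
  subst₂ _≤_ (sym (adversary-totalCost init N)) (cong (suc m *_) (sym (victim-serverCost init N)))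
    (+-monoʳ-≤ (suc N) (m≤m*n m (suc N))) ,
  λ where
    zero    0≢0 → contradiction refl 0≢0
    (suc j) _   → ≤-reflexive (home-serverCost init N j)

lru-unfair : ∀ (α : ℕ → ℚ) (β : ℕ → ℕ → ℚ) → IsLittleO α → (∀ k → IsLittleO (β k)) →
  Σ ℕ λ K → ∀ k → K ≤ k → 1 ≤ k → (init : Fin k → ℕ) →
    Σ (List ℕ) λ σ → Σ (Fin k) λ i → ViolatesFairness init (α k) (β k (totalCost init σ)) σ i
lru-unfair α β α-small β-small with α-small ¼ (ℚₚ.positive⁻¹ ¼)
... | K₀ , α-bound = K₀ , violation
  where
  violation : ∀ k → K₀ ≤ k → 1 ≤ k → (init : Fin k → ℕ) →
    Σ (List ℕ) λ σ → Σ (Fin k) λ i → ViolatesFairness init (α k) (β k (totalCost init σ)) σ i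
  violation (suc m) K₀≤k _ init with β-small (suc m) ¼ (ℚₚ.positive⁻¹ ¼)
  ... | T₀ , β-bound = adversary init N , zero , unfair
    where
    N = T₀ + suc m
    T₀≤total : T₀ ≤ suc N + m
    T₀≤total = ≤-trans (m≤m+n T₀ (suc m)) (≤-trans (n≤1+n N) (m≤m+n (suc N) m))
    total<2victim : ℕ→ℚ (suc N + m) ℚ.< ℕ→ℚ (suc N) ℚ.+ ℕ→ℚ (suc N)
    total<2victim = subst (ℕ→ℚ (suc N + m) ℚ.<_) (ℕ→ℚ-homo-+ (suc N) (suc N))
      (ℕ→ℚ-mono-< (+-monoʳ-< (suc N) (s≤s (≤-trans (n≤1+n m) (m≤n+m (suc m) T₀)))))
    -- Not 'rewrite': it makes Agda normalise ℕ→ℚ on open terms, i.e. evaluate gcd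
    -- symbolically, which exhausts memory.
    unfair : ViolatesFairness init (α (suc m)) (β (suc m) (totalCost init (adversary init N)))
                              (adversary init N) zero
    unfair = subst₂ (λ T C → α (suc m) ℚ.* ℕ→ℚ T ℚ.+ ℕ→ℚ (suc m) ℚ.* β (suc m) T
                               ℚ.< ℕ→ℚ (suc m) ℚ.* ℕ→ℚ C)
      (sym (adversary-totalCost init N)) (sym (victim-serverCost init N))
      (quarter-bounds⇒< {α (suc m)} {β (suc m) (suc N + m)}
                         {ℕ→ℚ (suc m)} {ℕ→ℚ (suc N + m)} {ℕ→ℚ (suc N)}
        {{ℕ→ℚ-suc-positive m}} {{ℕ→ℚ-nonNegative (suc N + m)}}
        (α-bound (suc m) K₀≤k) (β-bound (suc N + m) T₀≤total) total<2victim)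

theorem14 :
    (∀ (k : ℕ) → 1 ≤ k → (init : Fin k → ℕ) →
      Σ ℕ λ a → Σ ℕ λ b → 1 ≤ a ×
        (∀ (N : ℕ) → Σ (List ℕ) λ σ → N ≤ totalCost init σ ×
          Σ (Fin k) λ i → totalCost init σ ≤ a * serverCost init σ i ×
            (∀ (j : Fin k) → j ≢ i → serverCost init σ j ≤ b)))
    ×
    (∀ (α : ℕ → ℚ) (β : ℕ → ℕ → ℚ) → IsLittleO α → (∀ k → IsLittleO (β k)) →
      Σ ℕ λ K → ∀ (k : ℕ) → K ≤ k → 1 ≤ k → (init : Fin k → ℕ) →
        Σ (List ℕ) λ σ → Σ (Fin k) λ i →
          ViolatesFairness init (α k) (β k (totalCost init σ)) σ i)
theorem14 = lru-concentrates-cost , lru-unfair
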